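{- There exists a $\{K_3,K_4\}$-decomposition of $K_{18}$ consisting of $15$ copies of $K_3$ and $18$ copies of $K_4$. Consequently $D(18,\{3,4\})\le 33$.
   Context: A $\{K_3,K_4\}$-decomposition of $K_v$ is a collection of subgraphs of $K_v$, each isomorphic to $K_3$ or $K_4$, whose edge sets partition $E(K_v)$. $D(v,\{3,4\})$ denotes the minimum number of subgraphs in a $\{K_3,K_4\}$-decomposition of $K_v$. -}

module Defs where

open import Data.Nat using (ℕ; _≤_; _+_)
open import Data.List using (_++_)
open import Data.Fin using (Fin)
open import Data.Fin.Properties using (_≟_)
open import Data.List using (List; length; filter)
open import Data.List.Relation.Unary.All using (All)
open import Data.List.Relation.Unary.Unique.Propositional using (Unique)
open import Data.List.Membership.Propositional using (_∈_)
open import Data.List.Relation.Unary.Any using (any?)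
open import Data.Product using (_×_; Σ; ∃-syntax)
open import Relation.Binary.PropositionalEquality using (_≡_; _≢_)
open import Relation.Nullary using (Dec)
open import Relation.Nullary.Decidable using (_×-dec_)

-- A block (a copy of K_k inside K_v) is given by its vertex set, a list of
-- pairwise distinct vertices of K_v (vertex set Fin v).
Block : ℕ → Set
Block v = List (Fin v)

IsClique : {v : ℕ} → ℕ → Block v → Set
IsClique k B = Unique B × length B ≡ k

_∈?_ : {v : ℕ} → (x : Fin v) → (B : Block v) → Dec (x ∈ B)
x ∈? B = any? (λ y → x ≟ y) B

ContainsEdge : {v : ℕ} → Fin v → Fin v → Block v → Set
ContainsEdge x y B = x ∈ B × y ∈ B

containsEdge? : {v : ℕ} → (x y : Fin v) → (B : Block v) → Dec (ContainsEdge x y B)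
containsEdge? x y B = (x ∈? B) ×-dec (y ∈? B)

edgeMultiplicity : {v : ℕ} → Fin v → Fin v → List (Block v) → ℕ
edgeMultiplicity x y Bs = length (filter (containsEdge? x y) Bs)

PartitionsEdges : {v : ℕ} → List (Block v) → Set
PartitionsEdges {v} Bs = (x y : Fin v) → x ≢ y → edgeMultiplicity x y Bs ≡ 1

record K34Decomposition (v : ℕ) : Set where
  field
    triangles : List (Block v)
    quads     : List (Block v)
    trianglesAreK3 : All (IsClique 3) triangles
    quadsAreK4     : All (IsClique 4) quads
    partitions     : PartitionsEdges (triangles ++ quads)

  size : ℕ
  size = length triangles + length quads

-- D(v,{3,4}) ≤ k : there is a {K_3,K_4}-decomposition of K_v with at most k
-- members (D is the minimum such size, so this is exactly "D(v,{3,4}) ≤ k").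
D≤ : ℕ → ℕ → Set
D≤ v k = ∃[ d ] (K34Decomposition.size {v} d ≤ k)

{-# OPTIONS --safe #-}
-- The decomposition is given explicitly; as a count check, 15 · 3 + 18 · 6 = 153 = C(18,2)
-- edges.
module Submission where

open import Defs
open import Data.Nat using (ℕ)
import Data.Nat.Properties as ℕ
open import Data.List using (List; []; _∷_; _++_; length)
open import Data.List.Relation.Unary.All using (all?)
import Data.List.Relation.Unary.Unique.DecPropositional as UniqueDec
open import Data.Fin using (#_)
open import Data.Fin.Properties using (_≟_) renaming (all? to ∀-Fin?)
open import Data.Product using (_×_; ∃-syntax; _,_)
open import Relation.Binary.PropositionalEquality using (_≡_; refl)
open import Relation.Nullary using (Dec; ¬?)
open import Relation.Nullary.Decidable using (_×-dec_; _→-dec_; from-yes)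

isClique? : {v : ℕ} (k : ℕ) (B : Block v) → Dec (IsClique k B)
isClique? k B = UniqueDec.unique? _≟_ B ×-dec (length B ℕ.≟ k)

partitionsEdges? : {v : ℕ} (Bs : List (Block v)) → Dec (PartitionsEdges Bs)
partitionsEdges? Bs =
  ∀-Fin? λ x → ∀-Fin? λ y → ¬? (x ≟ y) →-dec (edgeMultiplicity x y Bs ℕ.≟ 1)

D≤-size : {v : ℕ} (d : K34Decomposition v) → D≤ v (K34Decomposition.size d)
D≤-size d = d , ℕ.≤-refl

K18-triangles : List (Block 18)
K18-triangles =
    (# 0 ∷ # 10 ∷ # 11 ∷ [])
  ∷ (# 1 ∷ # 9  ∷ # 11 ∷ [])
  ∷ (# 2 ∷ # 9  ∷ # 10 ∷ [])
  ∷ (# 3 ∷ # 13 ∷ # 14 ∷ [])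
  ∷ (# 4 ∷ # 12 ∷ # 14 ∷ [])
  ∷ (# 5 ∷ # 12 ∷ # 13 ∷ [])
  ∷ (# 6 ∷ # 15 ∷ # 16 ∷ [])
  ∷ (# 7 ∷ # 16 ∷ # 17 ∷ [])
  ∷ (# 8 ∷ # 15 ∷ # 17 ∷ [])
  ∷ (# 9  ∷ # 13 ∷ # 16 ∷ [])
  ∷ (# 9  ∷ # 14 ∷ # 15 ∷ [])
  ∷ (# 10 ∷ # 12 ∷ # 16 ∷ [])
  ∷ (# 10 ∷ # 14 ∷ # 17 ∷ [])
  ∷ (# 11 ∷ # 12 ∷ # 15 ∷ [])
  ∷ (# 11 ∷ # 13 ∷ # 17 ∷ [])
  ∷ []

K18-quads : List (Block 18)
K18-quads =
    (# 0 ∷ # 1 ∷ # 6  ∷ # 13 ∷ [])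
  ∷ (# 0 ∷ # 2 ∷ # 8  ∷ # 12 ∷ [])
  ∷ (# 0 ∷ # 3 ∷ # 7  ∷ # 15 ∷ [])
  ∷ (# 0 ∷ # 4 ∷ # 9  ∷ # 17 ∷ [])
  ∷ (# 0 ∷ # 5 ∷ # 14 ∷ # 16 ∷ [])
  ∷ (# 1 ∷ # 2 ∷ # 7  ∷ # 14 ∷ [])
  ∷ (# 1 ∷ # 3 ∷ # 12 ∷ # 17 ∷ [])
  ∷ (# 1 ∷ # 4 ∷ # 8  ∷ # 16 ∷ [])
  ∷ (# 1 ∷ # 5 ∷ # 10 ∷ # 15 ∷ [])
  ∷ (# 2 ∷ # 3 ∷ # 11 ∷ # 16 ∷ [])
  ∷ (# 2 ∷ # 4 ∷ # 13 ∷ # 15 ∷ [])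
  ∷ (# 2 ∷ # 5 ∷ # 6  ∷ # 17 ∷ [])
  ∷ (# 3 ∷ # 4 ∷ # 6  ∷ # 10 ∷ [])
  ∷ (# 3 ∷ # 5 ∷ # 8  ∷ # 9  ∷ [])
  ∷ (# 4 ∷ # 5 ∷ # 7  ∷ # 11 ∷ [])
  ∷ (# 6 ∷ # 7 ∷ # 9  ∷ # 12 ∷ [])
  ∷ (# 6 ∷ # 8 ∷ # 11 ∷ # 14 ∷ [])
  ∷ (# 7 ∷ # 8 ∷ # 10 ∷ # 13 ∷ [])
  ∷ []

K18-decomposition : K34Decomposition 18
K18-decomposition = record
  { triangles      = K18-triangles
  ; quads          = K18-quads
  ; trianglesAreK3 = from-yes (all? (isClique? 3) K18-triangles)
  ; quadsAreK4     = from-yes (all? (isClique? 4) K18-quads)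
  ; partitions     = from-yes (partitionsEdges? (K18-triangles ++ K18-quads))
  }

lemma10 : (∃[ d ] (length (K34Decomposition.triangles {18} d) ≡ 15
                   × length (K34Decomposition.quads {18} d) ≡ 18))
          × D≤ 18 33
lemma10 = (K18-decomposition , refl , refl) , D≤-size K18-decomposition
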